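{- Every Fitch graph that contains no bi-directional edges (i.e., no pair of edges $(x,y),(y,x)$) is a directed acyclic graph.
   Context: All digraphs are finite and have irreflexive edge sets. A rooted tree is a finite directed tree with all edges directed away from a unique root, in which no non-root vertex has exactly one child; $\mathrm{lca}_T(x,y)$ denotes the least common ancestor of $x,y$. A digraph $G=(V,E)$ is a Fitch graph if it is isomorphic to a digraph $\mathbb{G}(T,\lambda)$, where $T$ is a rooted tree with leaf set $V$, $\lambda\colon E(T)\to\{0,1\}$, and $\mathbb{G}(T,\lambda)$ has vertex set $V$ and contains the edge $(x,y)$, for distinct $x,y\in V$, if and only if the unique path in $T$ from $\mathrm{lca}_T(x,y)$ to $y$ contains at least one edge labeled $1$. -}

module Defs where

open import Data.Nat using (ℕ; _≤_)
open import Data.Bool using (Bool; true; false)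
open import Data.Fin using (Fin)
open import Data.List using (List; []; _∷_; _++_; length; lookup)
open import Data.List.Membership.Propositional using (_∈_)
open import Data.List.Relation.Unary.Unique.Propositional using (Unique)
open import Data.Product using (Σ; _×_; _,_; proj₁; proj₂)
open import Data.Sum using (_⊎_)
open import Relation.Nullary using (¬_)
open import Relation.Binary.PropositionalEquality using (_≡_; _≢_)
open import Relation.Binary.Construct.Closure.Transitive using (TransClosure)
open import Function.Bundles using (_⤖_; Bijection)

Digraph : ℕ → Set₁
Digraph n = Fin n → Fin n → Set

Irreflexive : ∀ {n} → Digraph n → Set
Irreflexive {n} E = (x : Fin n) → ¬ E x x

NoBidirectional : ∀ {n} → Digraph n → Set
NoBidirectional {n} E = (x y : Fin n) → E x y → ¬ E y x

IsDAG : ∀ {n} → Digraph n → Set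
IsDAG {n} E = (x : Fin n) → ¬ TransClosure E x x

-- An internal node carries the list of its children, each paired with
-- the 0/1 label (false = 0, true = 1) of the edge from the node to it.

data Tree (L : Set) : Set where
  leaf : L → Tree L
  node : List (Bool × Tree L) → Tree L

module _ {L : Set} where

  mutual
    leaves : Tree L → List L
    leaves (leaf x)  = x ∷ []
    leaves (node cs) = leavesL cs

    leavesL : List (Bool × Tree L) → List L
    leavesL []             = []
    leavesL ((_ , c) ∷ cs) = leaves c ++ leavesL cs

  -- every internal node has at least two children (so no vertex has
  -- exactly one child, and every childless vertex is a labelled leaf)
  data NoUnary : Tree L → Set where
    leaf : ∀ {x} → NoUnary (leaf x)
    node : ∀ {cs} → 2 ≤ length cs →
           ((i : Fin (length cs)) → NoUnary (proj₂ (lookup cs i))) →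
           NoUnary (node cs)

  data _∈T_ (y : L) : Tree L → Set where
    here  : y ∈T leaf y
    child : ∀ {cs} (i : Fin (length cs)) →
            y ∈T proj₂ (lookup cs i) → y ∈T node cs

  data OneTo : Tree L → L → Set where
    direct : ∀ {cs y} (i : Fin (length cs)) →
             proj₁ (lookup cs i) ≡ true → y ∈T proj₂ (lookup cs i) →
             OneTo (node cs) y
    deeper : ∀ {cs y} (i : Fin (length cs)) →
             OneTo (proj₂ (lookup cs i)) y → OneTo (node cs) y

  -- Edge (x , y) of G(T, λ): the path from lca(x,y) to y contains a 1-edge.
  -- Either x, y lie in the same child subtree (recurse), or the current
  -- node is their lca: x lies below child i, y below child j ≠ i, and
  -- the path node → child j → ... → y contains an edge labelled 1.
  data FitchEdge : Tree L → L → L → Set where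
    same  : ∀ {cs x y} (i : Fin (length cs)) →
            FitchEdge (proj₂ (lookup cs i)) x y → FitchEdge (node cs) x y
    split : ∀ {cs x y} (i j : Fin (length cs)) → i ≢ j →
            x ∈T proj₂ (lookup cs i) →
            ((proj₁ (lookup cs j) ≡ true × y ∈T proj₂ (lookup cs j))
              ⊎ OneTo (proj₂ (lookup cs j)) y) →
            FitchEdge (node cs) x y

  record IsTreeOn (T : Tree L) : Set where
    field
      noUnary  : NoUnary T
      unique   : Unique (leaves T)
      complete : (x : L) → x ∈ leaves T

IsFitch : ∀ {n} → Digraph n → Set
IsFitch {n} E =
  Σ (Tree (Fin n)) λ T → IsTreeOn T ×
  Σ (Fin n ⤖ Fin n) λ σ →
    (x y : Fin n) → (E x y → FitchEdge T (Bijection.to σ x) (Bijection.to σ y))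
                  × (FitchEdge T (Bijection.to σ x) (Bijection.to σ y) → E x y)

{-# OPTIONS --safe #-}
module Submission where

-- A walk in G(T, λ) that crosses between two child subtrees of the root enters the
-- subtree of some y through a 1-edge, so every vertex outside that subtree has an
-- edge to y. A further edge leaving the subtree would make its target and y adjacent
-- in both directions, hence the walk stays there and cannot close up. Cycles inside
-- a single child subtree are excluded by induction on the tree.

open import Defs
open import Data.Nat using (ℕ)
open import Data.Bool using (Bool; true)
open import Data.Fin using (Fin; zero; suc)
open import Data.List using (List; []; _∷_; _++_; length; lookup)
open import Data.List.Membership.Propositional using (_∈_)
open import Data.List.Membership.Propositional.Properties using (∈-++⁺ˡ; ∈-++⁺ʳ)
open import Data.List.Relation.Binary.Disjoint.Propositional using (Disjoint)
open import Data.List.Relation.Unary.Any using (here; there)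
open import Data.List.Relation.Unary.All as All using ()
open import Data.List.Relation.Unary.All.Properties using (++⁻ˡ)
open import Data.List.Relation.Unary.AllPairs using ([]; _∷_)
open import Data.List.Relation.Unary.Unique.Propositional using (Unique)
open import Data.Product using (Σ; _×_; _,_; proj₁; proj₂)
open import Data.Sum using (_⊎_; inj₁; inj₂)
open import Data.Empty using (⊥-elim)
open import Relation.Nullary using (¬_)
open import Relation.Binary.PropositionalEquality using (_≡_; _≢_; refl; sym; trans; subst; cong)
open import Relation.Binary.Construct.Closure.Transitive using (TransClosure; [_]; _∷_)
open import Function.Bundles using (Bijection)

Unique-++⁻ : ∀ {A : Set} (xs : List A) {ys : List A} → Unique (xs ++ ys) →
             Unique xs × Unique ys × Disjoint xs ys
Unique-++⁻ []       ys! = [] , ys! , λ ()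
Unique-++⁻ (x ∷ xs) (x∉ ∷ xs++ys!) with Unique-++⁻ xs xs++ys!
... | xs! , ys! , xs#ys = ++⁻ˡ xs x∉ ∷ xs! , ys! , disjoint
  where
    disjoint : Disjoint (x ∷ xs) _
    disjoint (here refl , v∈ys) = All.lookup x∉ (∈-++⁺ʳ xs v∈ys) refl
    disjoint (there v∈xs , v∈ys) = xs#ys (v∈xs , v∈ys)

TransClosure-map : ∀ {A B : Set} {R : A → A → Set} {S : B → B → Set} (f : A → B) →
                   (∀ {a b} → R a b → S (f a) (f b)) →
                   ∀ {a b} → TransClosure R a b → TransClosure S (f a) (f b)
TransClosure-map f R⇒S [ r ]     = [ R⇒S r ]
TransClosure-map f R⇒S (r ∷ rs) = R⇒S r ∷ TransClosure-map f R⇒S rs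

module _ {L : Set} where

  subtree : (cs : List (Bool × Tree L)) → Fin (length cs) → Tree L
  subtree cs i = proj₂ (lookup cs i)

  OneThrough : (cs : List (Bool × Tree L)) → Fin (length cs) → L → Set
  OneThrough cs j y = (proj₁ (lookup cs j) ≡ true × y ∈T subtree cs j)
                    ⊎ OneTo (subtree cs j) y

  FitchNoBidirectional : Tree L → Set
  FitchNoBidirectional t = ∀ x y → FitchEdge t x y → ¬ FitchEdge t y x

  Tree-ind : (P : Tree L → Set) → (∀ x → P (leaf x)) →
             (∀ cs → (∀ i → P (subtree cs i)) → P (node cs)) → ∀ t → P t
  subtrees-ind : (P : Tree L → Set) → (∀ x → P (leaf x)) →
                 (∀ cs → (∀ i → P (subtree cs i)) → P (node cs)) →
                 ∀ cs i → P (subtree cs i)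

  Tree-ind P P-leaf P-node (leaf x)  = P-leaf x
  Tree-ind P P-leaf P-node (node cs) = P-node cs (subtrees-ind P P-leaf P-node cs)

  subtrees-ind P P-leaf P-node ((_ , t) ∷ cs) zero    = Tree-ind P P-leaf P-node t
  subtrees-ind P P-leaf P-node (_ ∷ cs)       (suc i) = subtrees-ind P P-leaf P-node cs i

  OneTo⇒∈T : ∀ {t : Tree L} {y : L} → OneTo t y → y ∈T t
  OneTo⇒∈T (direct i _ y∈) = child i y∈
  OneTo⇒∈T (deeper i o)    = child i (OneTo⇒∈T o)

  OneThrough⇒∈T : ∀ cs j {y} → OneThrough cs j y → y ∈T subtree cs j
  OneThrough⇒∈T _ _ (inj₁ (_ , y∈)) = y∈
  OneThrough⇒∈T _ _ (inj₂ o)        = OneTo⇒∈T o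

  FitchEdge⇒source∈T : ∀ {t : Tree L} {x y : L} → FitchEdge t x y → x ∈T t
  FitchEdge⇒source∈T (same i e)          = child i (FitchEdge⇒source∈T e)
  FitchEdge⇒source∈T (split i _ _ x∈ _)  = child i x∈

  FitchEdge⇒target∈T : ∀ {t : Tree L} {x y : L} → FitchEdge t x y → y ∈T t
  FitchEdge⇒target∈T (same i e)         = child i (FitchEdge⇒target∈T e)
  FitchEdge⇒target∈T (split {cs} _ j _ _ o) = child j (OneThrough⇒∈T cs j o)

  FitchWalk⇒source∈T : ∀ {t : Tree L} {x y : L} → TransClosure (FitchEdge t) x y → x ∈T t
  FitchWalk⇒source∈T [ e ]   = FitchEdge⇒source∈T e
  FitchWalk⇒source∈T (e ∷ _) = FitchEdge⇒source∈T e

  ∈subtree⇒∈leavesL : ∀ cs i {y} → y ∈ leaves (subtree cs i) → y ∈ leavesL cs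
  ∈subtree⇒∈leavesL (_ ∷ cs)       zero    y∈ = ∈-++⁺ˡ y∈
  ∈subtree⇒∈leavesL ((_ , t) ∷ cs) (suc i) y∈ = ∈-++⁺ʳ (leaves t) (∈subtree⇒∈leavesL cs i y∈)

  ∈T⇒∈leaves : ∀ {t : Tree L} {y : L} → y ∈T t → y ∈ leaves t
  ∈T⇒∈leaves here                = here refl
  ∈T⇒∈leaves (child {cs} i y∈)  = ∈subtree⇒∈leavesL cs i (∈T⇒∈leaves y∈)

  Unique-subtree : ∀ cs → Unique (leavesL cs) → ∀ i → Unique (leaves (subtree cs i))
  Unique-subtree ((_ , t) ∷ cs) cs! zero    = proj₁ (Unique-++⁻ (leaves t) cs!)
  Unique-subtree ((_ , t) ∷ cs) cs! (suc i) =
    Unique-subtree cs (proj₁ (proj₂ (Unique-++⁻ (leaves t) cs!))) i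

  ∈leaves-subtree-unique : ∀ cs → Unique (leavesL cs) → ∀ i j {y} →
                           y ∈ leaves (subtree cs i) → y ∈ leaves (subtree cs j) → i ≡ j
  ∈leaves-subtree-unique (_ ∷ cs) _ zero zero _ _ = refl
  ∈leaves-subtree-unique ((_ , t) ∷ cs) cs! zero (suc j) y∈t y∈j =
    ⊥-elim (proj₂ (proj₂ (Unique-++⁻ (leaves t) cs!)) (y∈t , ∈subtree⇒∈leavesL cs j y∈j))
  ∈leaves-subtree-unique ((_ , t) ∷ cs) cs! (suc i) zero y∈i y∈t =
    ⊥-elim (proj₂ (proj₂ (Unique-++⁻ (leaves t) cs!)) (y∈t , ∈subtree⇒∈leavesL cs i y∈i))
  ∈leaves-subtree-unique ((_ , t) ∷ cs) cs! (suc i) (suc j) y∈i y∈j =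
    cong suc (∈leaves-subtree-unique cs (proj₁ (proj₂ (Unique-++⁻ (leaves t) cs!))) i j y∈i y∈j)

  module FitchNode (cs : List (Bool × Tree L)) (cs! : Unique (leavesL cs))
                   (nb : FitchNoBidirectional (node cs)) where

    ∈T-subtree-unique : ∀ {i j y} → y ∈T subtree cs i → y ∈T subtree cs j → i ≡ j
    ∈T-subtree-unique {i} {j} y∈i y∈j =
      ∈leaves-subtree-unique cs cs! i j (∈T⇒∈leaves y∈i) (∈T⇒∈leaves y∈j)

    -- An edge z → w leaving subtree j would also be an edge y → w, while w → y
    -- holds because the path to y carries a 1.
    edge-stays-in-subtree : ∀ j {y z w} → OneThrough cs j y → z ∈T subtree cs j →
                            FitchEdge (node cs) z w → w ∈T subtree cs j
    edge-stays-in-subtree _ _ z∈j (same i e) =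
      subst (λ l → _ ∈T subtree cs l)
            (∈T-subtree-unique (FitchEdge⇒source∈T e) z∈j) (FitchEdge⇒target∈T e)
    edge-stays-in-subtree j y↓ z∈j (split i k i≢k z∈i w↓) =
      ⊥-elim (nb _ _ (split j k j≢k (OneThrough⇒∈T cs j y↓) w↓)
                     (split k j (λ k≡j → j≢k (sym k≡j)) (OneThrough⇒∈T cs k w↓) y↓))
      where
        j≢k : j ≢ k
        j≢k j≡k = i≢k (trans (∈T-subtree-unique z∈i z∈j) j≡k)

    walk-stays-in-subtree : ∀ j {y z w} → OneThrough cs j y → z ∈T subtree cs j →
                            TransClosure (FitchEdge (node cs)) z w → w ∈T subtree cs j
    walk-stays-in-subtree j y↓ z∈j [ e ]    = edge-stays-in-subtree j y↓ z∈j e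
    walk-stays-in-subtree j y↓ z∈j (e ∷ es) =
      walk-stays-in-subtree j y↓ (edge-stays-in-subtree j y↓ z∈j e) es

    walk-inside-or-across : ∀ {u w} → TransClosure (FitchEdge (node cs)) u w →
      (Σ (Fin (length cs)) λ i → TransClosure (FitchEdge (subtree cs i)) u w)
      ⊎ (Σ (Fin (length cs)) λ i → Σ (Fin (length cs)) λ j →
           i ≢ j × u ∈T subtree cs i × w ∈T subtree cs j)
    walk-inside-or-across [ same i e ] = inj₁ (i , [ e ])
    walk-inside-or-across [ split i j i≢j u∈i w↓ ] =
      inj₂ (i , j , i≢j , u∈i , OneThrough⇒∈T cs j w↓)
    walk-inside-or-across (split i j i≢j u∈i y↓ ∷ es) =
      inj₂ (i , j , i≢j , u∈i , walk-stays-in-subtree j y↓ (OneThrough⇒∈T cs j y↓) es)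
    walk-inside-or-across (same i e ∷ es) with walk-inside-or-across es
    ... | inj₁ (k , es-in-k) =
      inj₁ (i , e ∷ subst (λ l → TransClosure (FitchEdge (subtree cs l)) _ _)
                          (∈T-subtree-unique (FitchWalk⇒source∈T es-in-k) (FitchEdge⇒target∈T e))
                          es-in-k)
    ... | inj₂ (k , j , k≢j , v∈k , w∈j) =
      inj₂ (k , j , k≢j ,
            subst (λ l → _ ∈T subtree cs l)
                  (∈T-subtree-unique (FitchEdge⇒target∈T e) v∈k) (FitchEdge⇒source∈T e) ,
            w∈j)

  FitchAcyclic : Tree L → Set
  FitchAcyclic t = ∀ u → ¬ TransClosure (FitchEdge t) u u

  FitchNoBidirectional⇒FitchAcyclic :
    ∀ t → Unique (leaves t) → FitchNoBidirectional t → FitchAcyclic t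
  FitchNoBidirectional⇒FitchAcyclic =
    Tree-ind (λ t → Unique (leaves t) → FitchNoBidirectional t → FitchAcyclic t)
             (λ _ _ _ _ → λ { [ () ] ; (() ∷ _) })
             nodeCase
    where
      nodeCase : ∀ cs →
        (∀ i → Unique (leaves (subtree cs i)) → FitchNoBidirectional (subtree cs i) →
               FitchAcyclic (subtree cs i)) →
        Unique (leavesL cs) → FitchNoBidirectional (node cs) → FitchAcyclic (node cs)
      nodeCase cs ih cs! nb u cycle with FitchNode.walk-inside-or-across cs cs! nb cycle
      ... | inj₁ (i , cycle-in-i) =
        ih i (Unique-subtree cs cs! i) (λ x y e e′ → nb x y (same i e) (same i e′)) u cycle-in-i
      ... | inj₂ (i , j , i≢j , u∈i , u∈j) =
        i≢j (FitchNode.∈T-subtree-unique cs cs! nb u∈i u∈j)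

corollary1 : (n : ℕ) (E : Digraph n) → Irreflexive E → IsFitch E →
    NoBidirectional E → IsDAG E
corollary1 n E _ (T , T-tree , σ , E⇔Fitch) E-nb x cycle =
  FitchNoBidirectional⇒FitchAcyclic T (IsTreeOn.unique T-tree) T-nb
    (to x) (TransClosure-map to (proj₁ (E⇔Fitch _ _)) cycle)
  where
    open Bijection σ using (to; strictlySurjective)

    T-nb : FitchNoBidirectional T
    T-nb a b e e′ with strictlySurjective a | strictlySurjective b
    ... | (x , refl) | (y , refl) =
      E-nb x y (proj₂ (E⇔Fitch x y) e) (proj₂ (E⇔Fitch y x) e′)
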